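{- Let $n\geq 1$ and let $B\in M_n(\mathbb{Z})$ be a skew-symmetric integer matrix. If $B'\in M_n(\mathbb{Z})$ is mutation equivalent to $B$, then $\delta(B')\equiv\delta(B)\pmod{4}$.
   Context: $M_n(\mathbb{Z})$ denotes the set of $n\times n$ integer matrices, and $[n]=\{1,\dots,n\}$. For a skew-symmetric $B=(b_{ij})\in M_n(\mathbb{Z})$, let $V(B)\in M_n(\mathbb{Z})$ be the matrix with $V(B)_{ij}=b_{ij}$ if $i<j$, $V(B)_{ii}=1$, and $V(B)_{ij}=0$ if $i>j$. Set $\mathfrak{S}(B):=V(B)+V(B)^t$. The $\delta$-invariant is $\delta(B):=\det(\mathfrak{S}(B))\pmod 4$. Mutation: for $k\in[n]$, let $J_{k,n}$ be the diagonal matrix with all diagonal entries $1$ except the $(k,k)$ entry, which is $-1$. Let $E_{k,n}=(e_{ij})$ be the $n\times n$ matrix with $e_{ik}=\max(0,-b_{ik})$ for all $i\in[n]$ and all other entries $0$. Set $M_k:=J_{k,n}+E_{k,n}$. The mutation of $B$ at $k$ is $\mu_k(B):=M_k B M_k^t$, which is again skew-symmetric. Two skew-symmetric matrices $B,B'\in M_n(\mathbb{Z})$ are mutation equivalent if one can get from $B$ to $B'$ by a finite sequence of mutations (at various indices), possibly followed by a simultaneous permutation of rows and columns, i.e. replacing a matrix $A$ by $PAP^t$ for a permutation matrix $P$. -}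

module Defs where

open import Data.Nat as ℕ using (ℕ; zero; suc)
open import Data.Bool using (Bool; true; false; if_then_else_)
open import Data.Integer using (ℤ; +_; -_; _+_; _*_; _⊔_)
open import Data.Integer.DivMod using (_%ℕ_)
open import Data.Fin using (Fin; zero; suc; toℕ; punchIn)
open import Data.Fin.Permutation using (Permutation′; _⟨$⟩ʳ_)
open import Relation.Binary.PropositionalEquality using (_≡_)

Mat : ℕ → Set
Mat n = Fin n → Fin n → ℤ

Σ : ∀ {n} → (Fin n → ℤ) → ℤ
Σ {zero}  f = + 0
Σ {suc n} f = f zero + Σ (λ i → f (suc i))

_·_ : ∀ {n} → Mat n → Mat n → Mat n
(A · C) i j = Σ (λ k → A i k * C k j)

transpose : ∀ {n} → Mat n → Mat n
transpose A i j = A j i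

_+ᴹ_ : ∀ {n} → Mat n → Mat n → Mat n
(A +ᴹ C) i j = A i j + C i j

sign : ℕ → ℤ
sign zero = + 1
sign (suc m) = - sign m

det : ∀ {n} → Mat n → ℤ
det {zero}  A = + 1
det {suc n} A = Σ (λ j → sign (toℕ j) * (A zero j * det (λ i k → A (suc i) (punchIn j k))))

IsSkewSymmetric : ∀ {n} → Mat n → Set
IsSkewSymmetric B = ∀ i j → B i j ≡ - B j i

V : ∀ {n} → Mat n → Mat n
V B i j = if toℕ i ℕ.<ᵇ toℕ j then B i j
          else (if toℕ i ℕ.≡ᵇ toℕ j then + 1 else + 0)

𝔖 : ∀ {n} → Mat n → Mat n
𝔖 B = V B +ᴹ transpose (V B)

δ : ∀ {n} → Mat n → ℕ
δ B = det (𝔖 B) %ℕ 4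

J : ∀ {n} → Fin n → Mat n
J k i j = if toℕ i ℕ.≡ᵇ toℕ j
          then (if toℕ i ℕ.≡ᵇ toℕ k then - (+ 1) else + 1)
          else + 0

E : ∀ {n} → Mat n → Fin n → Mat n
E B k i j = if toℕ j ℕ.≡ᵇ toℕ k then (+ 0 ⊔ (- B i k)) else + 0

Mk : ∀ {n} → Mat n → Fin n → Mat n
Mk B k = J k +ᴹ E B k

μ : ∀ {n} → Fin n → Mat n → Mat n
μ k B = (Mk B k · B) · transpose (Mk B k)

data Mutations {n : ℕ} : Mat n → Mat n → Set where
  done : ∀ {B} → Mutations B B
  step : ∀ {B B'} (k : Fin n) → Mutations (μ k B) B' → Mutations B B'

-- P A Pᵗ for the permutation matrix P of σ (P_{i,σ(i)} = 1): entry (i,j) is A_{σ(i),σ(j)}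
permute : ∀ {n} → Permutation′ n → Mat n → Mat n
permute σ A i j = A (σ ⟨$⟩ʳ i) (σ ⟨$⟩ʳ j)

MutationEquivalent : ∀ {n} → Mat n → Mat n → Set
MutationEquivalent {n} B B' =
  Σ' (Mat n) (λ C → Σ' (Permutation′ n) (λ σ → Mutations B C × (∀ i j → B' i j ≡ permute σ C i j)))
  where
  open import Data.Product using (_×_) renaming (Σ to Σ')

-- For any integer matrices X and Y with the same skew part X − Xᵗ = Y − Yᵗ and diagonals of
-- the same parity, W = X − Y is symmetric with even diagonal, so X + Xᵗ = (Y + Yᵗ) + 2W and
-- 2W ≡ 2(U + Uᵗ) (mod 4) for the upper triangle U of W. The determinant is quadratic modulo 4,
-- det(A + 2X + 2Y) + det A ≡ det(A + 2X) + det(A + 2Y), and det(S + 2U) = det(S + 2Uᵗ) ≡ det S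
-- (mod 2) for symmetric S; hence det(X + Xᵗ) ≡ det(Y + Yᵗ) (mod 4).
-- A mutation has μ_k(B) = F − Fᵗ for F = M_k V(B) M_kᵗ, whose diagonal is odd because
-- e_ik (b_ik + e_ik) = 0, and F + Fᵗ = M_k 𝔖(B) M_kᵗ has the determinant of 𝔖(B) since
-- det M_k = −1. A simultaneous permutation P is handled the same way with F = P V(B) Pᵗ.

module Submission where

open import Defs
open import Data.Nat using (ℕ; _≤_)
open import Relation.Binary.PropositionalEquality using (_≡_)

open import Data.Nat as ℕ using (zero; suc)
import Data.Nat.Properties as ℕ
import Data.Nat.Divisibility as ℕ
open import Data.Integer as ℤ using (ℤ; +_; -[1+_]; -_; _+_; _*_; _-_; _⊔_; _%ℕ_; _/ℕ_)
import Data.Integer.Properties as ℤP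
open import Data.Integer.Divisibility.Signed
  using (_∣_; divides; ∣m∣n⇒∣m+n; ∣m∣n⇒∣m-n; ∣m⇒∣-m; ∣n⇒∣m*n; ∣m⇒∣m*n; *-monoʳ-∣; ∣⇒∣ᵤ)
open import Data.Integer.DivMod using (a≡a%ℕn+[a/ℕn]*n; n%ℕd<d)
open import Data.Integer.Tactic.RingSolver using (solve-∀)
open import Algebra.Properties.Semiring.Sum ℤP.+-*-semiring
  using (sum; sum-cong-≗; ∑-distrib-+; ∑-comm; *-distribˡ-sum; sum-replicate-zero; sum-remove)
open import Data.Fin using (Fin; zero; suc; toℕ; fromℕ<; punchIn)
open import Data.Fin.Properties as Fin using (punchInᵢ≢i; suc-injective)
import Data.Fin.Permutation.Components as PC
import Data.Fin.Permutation as Perm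
open Perm using (Permutation′; _⟨$⟩ʳ_; _⟨$⟩ˡ_)
open import Data.Bool using (true; false; if_then_else_)
open import Relation.Nullary using (Dec; yes; no)
open import Relation.Binary.Definitions using (tri<; tri≈; tri>)
open import Relation.Nullary.Decidable using (dec-true; dec-false)
open import Data.Empty using (⊥-elim)
open import Data.Product using (_×_; _,_; proj₁; proj₂)
open import Relation.Binary.PropositionalEquality using (refl; sym; trans; cong; cong₂; subst; subst₂; _≢_)
open Relation.Binary.PropositionalEquality.≡-Reasoning

-- Finite sums and congruences

Σ≡sum : ∀ {n} (f : Fin n → ℤ) → Σ f ≡ sum f
Σ≡sum {zero}  f = refl
Σ≡sum {suc n} f = cong (λ s → f zero + s) (Σ≡sum (λ i → f (suc i)))

Σ-cong : ∀ {n} {f g : Fin n → ℤ} → (∀ i → f i ≡ g i) → Σ f ≡ Σ g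
Σ-cong {f = f} {g} f≗g = trans (Σ≡sum f) (trans (sum-cong-≗ {x = f} {y = g} f≗g) (sym (Σ≡sum g)))

Σ-distrib-+ : ∀ {n} (f g : Fin n → ℤ) → Σ (λ i → f i + g i) ≡ Σ f + Σ g
Σ-distrib-+ f g = trans (Σ≡sum (λ i → f i + g i)) (trans (∑-distrib-+ f g) (sym (cong₂ _+_ (Σ≡sum f) (Σ≡sum g))))

*-distribˡ-Σ : ∀ {n} c (f : Fin n → ℤ) → c * Σ f ≡ Σ (λ i → c * f i)
*-distribˡ-Σ c f = trans (cong (c *_) (Σ≡sum f)) (trans (*-distribˡ-sum c f) (sym (Σ≡sum (λ i → c * f i))))

Σ-zero : ∀ {n} (f : Fin n → ℤ) → (∀ i → f i ≡ + 0) → Σ f ≡ + 0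
Σ-zero {n} f f≗0 = trans (Σ-cong f≗0) (trans (Σ≡sum {n} (λ _ → + 0)) (sum-replicate-zero n))

Σ-comm : ∀ {m n} (f : Fin m → Fin n → ℤ) → Σ (λ i → Σ (λ j → f i j)) ≡ Σ (λ j → Σ (λ i → f i j))
Σ-comm f = begin
  Σ (λ i → Σ (f i))           ≡⟨ Σ-cong (λ i → Σ≡sum (f i)) ⟩
  Σ (λ i → sum (f i))         ≡⟨ Σ≡sum (λ i → sum (f i)) ⟩
  sum (λ i → sum (f i))       ≡⟨ ∑-comm f ⟩
  sum (λ j → sum (λ i → f i j)) ≡⟨ Σ≡sum (λ j → sum (λ i → f i j)) ⟨
  Σ (λ j → sum (λ i → f i j)) ≡⟨ Σ-cong (λ j → sym (Σ≡sum (λ i → f i j))) ⟩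
  Σ (λ j → Σ (λ i → f i j))   ∎

Σ-single : ∀ {n} (k : Fin n) (f : Fin n → ℤ) → (∀ i → i ≢ k → f i ≡ + 0) → Σ f ≡ f k
Σ-single {suc n} k f f≗0 = begin
  Σ f                                   ≡⟨ Σ≡sum f ⟩
  sum f                                 ≡⟨ sum-remove f ⟩
  f k + sum (λ i → f (punchIn k i))     ≡⟨ cong (λ s → f k + s) (sym (Σ≡sum (λ i → f (punchIn k i)))) ⟩
  f k + Σ (λ i → f (punchIn k i))       ≡⟨ cong (λ s → f k + s) (Σ-zero (λ i → f (punchIn k i)) (λ i → f≗0 _ (punchInᵢ≢i k i))) ⟩
  f k + + 0                             ≡⟨ ℤP.+-identityʳ (f k) ⟩
  f k                                   ∎

Σ-neg-factor : ∀ {n} (x y z : Fin n → ℤ) → Σ (λ i → x i * (y i * - z i)) ≡ - Σ (λ i → x i * (y i * z i))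
Σ-neg-factor x y z = begin
  Σ (λ i → x i * (y i * - z i))          ≡⟨ Σ-cong (λ i → neg-inside (x i) (y i) (z i)) ⟩
  Σ (λ i → - + 1 * (x i * (y i * z i)))  ≡⟨ *-distribˡ-Σ (- + 1) (λ i → x i * (y i * z i)) ⟨
  - + 1 * Σ (λ i → x i * (y i * z i))    ≡⟨ ℤP.-1*i≡-i (Σ (λ i → x i * (y i * z i))) ⟩
  - Σ (λ i → x i * (y i * z i))          ∎
  where
  neg-inside : ∀ x y z → x * (y * - z) ≡ - + 1 * (x * (y * z))
  neg-inside = solve-∀

self-negating : ∀ x → x ≡ - x → x ≡ + 0
self-negating (+ zero)  _  = refl
self-negating (+ suc n) ()
self-negating -[1+ n ]  ()

-- A record rather than a synonym for m ∣ a - b, so that a and b remain inferable.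
infix 4 _≡[_]_
record _≡[_]_ (a m b : ℤ) : Set where
  constructor congruent
  field ∣difference : m ∣ a - b
open _≡[_]_ using (∣difference)

module _ {m : ℤ} where

  mod-refl : ∀ {a} → a ≡[ m ] a
  mod-refl {a} = congruent (divides (+ 0) (ℤP.+-inverseʳ a))

  mod-reflexive : ∀ {a b} → a ≡ b → a ≡[ m ] b
  mod-reflexive refl = mod-refl

  mod-sym : ∀ {a b} → a ≡[ m ] b → b ≡[ m ] a
  mod-sym {a} {b} (congruent a≡b) = congruent (subst (m ∣_) (neg-difference a b) (∣m⇒∣-m a≡b))
    where
    neg-difference : ∀ a b → - (a - b) ≡ b - a
    neg-difference = solve-∀

  mod-trans : ∀ {a b c} → a ≡[ m ] b → b ≡[ m ] c → a ≡[ m ] c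
  mod-trans {a} {b} {c} (congruent a≡b) (congruent b≡c) =
    congruent (subst (m ∣_) (telescope a b c) (∣m∣n⇒∣m+n a≡b b≡c))
    where
    telescope : ∀ a b c → (a - b) + (b - c) ≡ a - c
    telescope = solve-∀

  mod-+ : ∀ {a b c d} → a ≡[ m ] b → c ≡[ m ] d → a + c ≡[ m ] b + d
  mod-+ {a} {b} {c} {d} (congruent a≡b) (congruent c≡d) =
    congruent (subst (m ∣_) (difference a b c d) (∣m∣n⇒∣m+n a≡b c≡d))
    where
    difference : ∀ a b c d → (a - b) + (c - d) ≡ (a + c) - (b + d)
    difference = solve-∀

  mod-* : ∀ {a b c d} → a ≡[ m ] b → c ≡[ m ] d → a * c ≡[ m ] b * d
  mod-* {a} {b} {c} {d} (congruent a≡b) (congruent c≡d) =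
    congruent (subst (m ∣_) (difference a b c d) (∣m∣n⇒∣m+n (∣n⇒∣m*n a c≡d) (∣m⇒∣m*n d a≡b)))
    where
    difference : ∀ a b c d → a * (c - d) + (a - b) * d ≡ a * c - b * d
    difference = solve-∀

  Σ-mod : ∀ {n} {f g : Fin n → ℤ} → (∀ i → f i ≡[ m ] g i) → Σ f ≡[ m ] Σ g
  Σ-mod {zero}  f≡g = mod-refl
  Σ-mod {suc n} f≡g = mod-+ (f≡g zero) (Σ-mod (λ i → f≡g (suc i)))

double-mod : ∀ {a b} → a ≡[ + 2 ] b → + 2 * a ≡[ + 4 ] + 2 * b
double-mod {a} {b} (congruent a≡b) = congruent (subst (+ 4 ∣_) (difference a b) (*-monoʳ-∣ (+ 2) a≡b))
  where
  difference : ∀ a b → + 2 * (a - b) ≡ + 2 * a - + 2 * b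
  difference = solve-∀

mod-cancel : ∀ {a b c} → a + b ≡[ + 4 ] c + c → b ≡[ + 2 ] c → a ≡[ + 4 ] b
mod-cancel {a} {b} {c} (congruent a+b≡2c) b≡c =
  congruent (subst (+ 4 ∣_) (difference a b c) (∣m∣n⇒∣m-n a+b≡2c (∣difference (double-mod b≡c))))
  where
  difference : ∀ a b c → (a + b) - (c + c) - (+ 2 * b - + 2 * c) ≡ a - b
  difference = solve-∀

%ℕ-cong : ∀ {a b} d .{{_ : ℕ.NonZero d}} → a ≡[ + d ] b → a %ℕ d ≡ b %ℕ d
%ℕ-cong {a} {b} d a≡b = ℤP.+-injective (ℤP.i-j≡0⇒i≡j (+ r) (+ s) (ℤP.∣i∣≡0⇒i≡0 r-s≡0))
  where
  r s : ℕ
  r = a %ℕ d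
  s = b %ℕ d
  remainder≡ : ∀ x → + (x %ℕ d) ≡[ + d ] x
  remainder≡ x = congruent (divides (- (x /ℕ d)) (trans (cong (λ y → + (x %ℕ d) - y) (a≡a%ℕn+[a/ℕn]*n x d)) (cancel (+ (x %ℕ d)) (x /ℕ d) (+ d))))
    where
    cancel : ∀ r q d → r - (r + q * d) ≡ - q * d
    cancel = solve-∀
  r≡s : + r ≡[ + d ] + s
  r≡s = mod-trans (mod-trans (remainder≡ a) a≡b) (mod-sym (remainder≡ b))
  r-s≡0 : ℤ.∣ + r - + s ∣ ≡ 0
  r-s≡0 with ℤ.∣ + r - + s ∣ in eq
  ... | zero  = refl
  ... | suc k = ⊥-elim (ℕ.<⇒≱ bound (ℕ.∣⇒≤ (subst (d ℕ.∣_) eq (∣⇒∣ᵤ (∣difference r≡s)))))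
    where
    bound : suc k ℕ.< d
    bound = ℕ.≤-<-trans (ℕ.≤-trans (ℕ.≤-reflexive (trans (sym eq) (cong ℤ.∣_∣ (ℤP.[+m]-[+n]≡m⊖n r s))))
                                   (ℤP.∣m⊝n∣≤m⊔n r s))
                        (ℕ.⊔-lub (n%ℕd<d a d) (n%ℕd<d b d))

-- Determinants

minor : ∀ {n} → Mat (suc n) → Fin (suc n) → Mat n
minor A j a b = A (suc a) (punchIn j b)

colMinor : ∀ {n} → Mat (suc n) → Fin (suc n) → Mat n
colMinor A i a b = A (punchIn i a) (suc b)

row₀-term : ∀ {n} → Mat (suc n) → Fin (suc n) → ℤ
row₀-term A j = sign (toℕ j) * (A zero j * det (minor A j))

col₀-term : ∀ {n} → Mat (suc n) → Fin (suc n) → ℤ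
col₀-term A i = sign (toℕ i) * (A i zero * det (colMinor A i))

det-cong : ∀ {n} {A B : Mat n} → (∀ i j → A i j ≡ B i j) → det A ≡ det B
det-cong {zero}  A≗B = refl
det-cong {suc n} A≗B = Σ-cong (λ j → cong₂ (λ x y → sign (toℕ j) * (x * y))
  (A≗B zero j) (det-cong (λ a b → A≗B (suc a) (punchIn j b))))

det-mod : ∀ {m n} {A B : Mat n} → (∀ i j → A i j ≡[ m ] B i j) → det A ≡[ m ] det B
det-mod {n = zero}  A≡B = mod-refl
det-mod {n = suc n} A≡B = Σ-mod (λ j → mod-* (mod-refl {a = sign (toℕ j)})
  (mod-* (A≡B zero j) (det-mod (λ a b → A≡B (suc a) (punchIn j b)))))

det-expand-col₀ : ∀ {n} (A : Mat (suc n)) → det A ≡ Σ (col₀-term A)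
det-expand-col₀ {zero}  A = refl
det-expand-col₀ {suc n} A = cong (λ x → sign 0 * (A zero zero * det (minor A zero)) + x) (begin
  Σ (λ k → - s k * (r k * det (minor A (suc k))))
    ≡⟨ Σ-cong (λ k → cong (λ d → - s k * (r k * d)) (det-expand-col₀ (minor A (suc k)))) ⟩
  Σ (λ k → - s k * (r k * Σ (λ i → s i * (c i * D i k))))
    ≡⟨ Σ-cong (λ k → pull-in (- s k) (r k) (λ i → s i * (c i * D i k))) ⟩
  Σ (λ k → Σ (λ i → - s k * (r k * (s i * (c i * D i k)))))
    ≡⟨ Σ-comm (λ k i → - s k * (r k * (s i * (c i * D i k)))) ⟩
  Σ (λ i → Σ (λ k → - s k * (r k * (s i * (c i * D i k)))))
    ≡⟨ Σ-cong (λ i → Σ-cong (λ k → exchange (s k) (r k) (s i) (c i) (D i k))) ⟩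
  Σ (λ i → Σ (λ k → - s i * (c i * (s k * (r k * D i k)))))
    ≡⟨ Σ-cong (λ i → pull-in (- s i) (c i) (λ k → s k * (r k * D i k))) ⟨
  Σ (λ i → - s i * (c i * Σ (λ k → s k * (r k * D i k))))
    ∎)
  where
  s : Fin (suc n) → ℤ
  s i = sign (toℕ i)
  r c : Fin (suc n) → ℤ
  r k = A zero (suc k)
  c i = A (suc i) zero
  D : Fin (suc n) → Fin (suc n) → ℤ
  D i k = det (λ a b → A (suc (punchIn i a)) (suc (punchIn k b)))
  pull-in : ∀ {m} x y (f : Fin m → ℤ) → x * (y * Σ f) ≡ Σ (λ i → x * (y * f i))
  pull-in x y f = trans (cong (x *_) (*-distribˡ-Σ y f)) (*-distribˡ-Σ x (λ i → y * f i))
  exchange : ∀ s a t b d → - s * (a * (t * (b * d))) ≡ - t * (b * (s * (a * d)))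
  exchange = solve-∀

det-transpose : ∀ {n} (A : Mat n) → det (transpose A) ≡ det A
det-transpose {zero}  A = refl
det-transpose {suc n} A = trans
  (Σ-cong (λ j → cong (λ d → sign (toℕ j) * (A j zero * d)) (det-transpose (colMinor A j))))
  (sym (det-expand-col₀ A))

record RowSwap {n} (a b : Fin n) (A B : Mat n) : Set where
  field
    at-a : ∀ j → B a j ≡ A b j
    at-b : ∀ j → B b j ≡ A a j
    elsewhere : ∀ i → i ≢ a → i ≢ b → ∀ j → B i j ≡ A i j

RowSwap-sym : ∀ {n} {a b : Fin n} {A B : Mat n} → RowSwap a b A B → RowSwap b a A B
RowSwap-sym sw = record { at-a = at-b ; at-b = at-a ; elsewhere = λ i i≢b i≢a → elsewhere i i≢a i≢b }
  where open RowSwap sw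

swap₀₁ : ∀ {n} {X : Set} → (Fin (suc (suc n)) → X) → Fin (suc (suc n)) → X
swap₀₁ f zero          = f (suc zero)
swap₀₁ f (suc zero)    = f zero
swap₀₁ f (suc (suc i)) = f (suc (suc i))

swap₀₁-RowSwap : ∀ {n} (A : Mat (suc (suc n))) → RowSwap zero (suc zero) A (swap₀₁ A)
swap₀₁-RowSwap A = record { at-a = λ _ → refl ; at-b = λ _ → refl ; elsewhere = elsewhere }
  where
  elsewhere : ∀ i → i ≢ zero → i ≢ suc zero → ∀ j → swap₀₁ A i j ≡ A i j
  elsewhere zero          i≢0 _   = ⊥-elim (i≢0 refl)
  elsewhere (suc zero)    _   i≢1 = ⊥-elim (i≢1 refl)
  elsewhere (suc (suc i)) _   _   _ = refl

det-swap₀₁ : ∀ {n} {A B : Mat (suc (suc n))} → RowSwap zero (suc zero) A B → det B ≡ - det A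
col₀-tail-swap₀₁ : ∀ {n} {A B : Mat (suc (suc n))} → RowSwap zero (suc zero) A B →
  Σ (λ i → col₀-term B (suc (suc i))) ≡ - Σ (λ i → col₀-term A (suc (suc i)))

det-swap₀₁ {n} {A} {B} sw = begin
  det B
    ≡⟨ det-expand-col₀ B ⟩
  sign 0 * p B zero + (sign 1 * p B (suc zero) + Σ (λ i → col₀-term B (suc (suc i))))
    ≡⟨ cong₂ (λ x y → sign 0 * x + y) (cong₂ _*_ (at-a zero) (det-cong minor₀))
         (cong₂ _+_ (cong₂ (λ x y → sign 1 * (x * y)) (at-b zero) (det-cong minor₁)) (col₀-tail-swap₀₁ sw)) ⟩
  sign 0 * p A (suc zero) + (sign 1 * p A zero + - Σ (λ i → col₀-term A (suc (suc i))))
    ≡⟨ regroup (p A zero) (p A (suc zero)) (Σ (λ i → col₀-term A (suc (suc i)))) ⟩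
  - (sign 0 * p A zero + (sign 1 * p A (suc zero) + Σ (λ i → col₀-term A (suc (suc i)))))
    ≡⟨ cong -_ (det-expand-col₀ A) ⟨
  - det A ∎
  where
  open RowSwap sw
  p : Mat (suc (suc n)) → Fin (suc (suc n)) → ℤ
  p X i = X i zero * det (colMinor X i)
  minor₀ : ∀ a b → colMinor B zero a b ≡ colMinor A (suc zero) a b
  minor₀ zero    b = at-b (suc b)
  minor₀ (suc a) b = elsewhere (suc (suc a)) (λ ()) (λ ()) (suc b)
  minor₁ : ∀ a b → colMinor B (suc zero) a b ≡ colMinor A zero a b
  minor₁ zero    b = at-a (suc b)
  minor₁ (suc a) b = elsewhere (suc (suc a)) (λ ()) (λ ()) (suc b)
  regroup : ∀ x y z → + 1 * y + (- + 1 * x + - z) ≡ - (+ 1 * x + (- + 1 * y + z))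
  regroup = solve-∀

col₀-tail-swap₀₁ {zero}  _ = refl
col₀-tail-swap₀₁ {suc n} {A} {B} sw = trans
  (Σ-cong (λ i → cong₂ (λ x y → sign (toℕ (suc (suc i))) * (x * y))
    (elsewhere (suc (suc i)) (λ ()) (λ ()) zero) (det-swap₀₁ (minor-swap i))))
  (Σ-neg-factor (λ i → sign (toℕ (suc (suc i)))) (λ i → A (suc (suc i)) zero) (λ i → det (colMinor A (suc (suc i)))))
  where
  open RowSwap sw
  minor-swap : ∀ i → RowSwap zero (suc zero) (colMinor A (suc (suc i))) (colMinor B (suc (suc i)))
  minor-swap i = record
    { at-a = λ b → at-a (suc b)
    ; at-b = λ b → at-b (suc b)
    ; elsewhere = λ { zero 0≢0 _ → ⊥-elim (0≢0 refl)
                    ; (suc zero) _ 1≢1 → ⊥-elim (1≢1 refl)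
                    ; (suc (suc a)) _ _ b → elsewhere (suc (suc (punchIn i a))) (λ ()) (λ ()) (suc b) } }

det-swap : ∀ {n} {a b : Fin n} {A B : Mat n} → a ≢ b → RowSwap a b A B → det B ≡ - det A
det-swap-suc : ∀ {n} {a b : Fin n} {A B : Mat (suc n)} → a ≢ b → RowSwap (suc a) (suc b) A B → det B ≡ - det A
det-swap₀ : ∀ {n} {b : Fin n} {A B : Mat (suc n)} → RowSwap zero (suc b) A B → det B ≡ - det A

det-swap-suc {n} {a} {b} {A} {B} a≢b sw = begin
  det B
    ≡⟨ Σ-cong (λ j → cong₂ (λ x y → sign (toℕ j) * (x * y))
         (elsewhere zero (λ ()) (λ ()) j) (det-swap a≢b (minor-swap j))) ⟩
  Σ (λ j → sign (toℕ j) * (A zero j * - det (minor A j)))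
    ≡⟨ Σ-neg-factor (λ j → sign (toℕ j)) (λ j → A zero j) (λ j → det (minor A j)) ⟩
  - det A ∎
  where
  open RowSwap sw
  minor-swap : ∀ j → RowSwap a b (minor A j) (minor B j)
  minor-swap j = record
    { at-a = λ c → at-a (punchIn j c)
    ; at-b = λ c → at-b (punchIn j c)
    ; elsewhere = λ i i≢a i≢b c → elsewhere (suc i) (λ eq → i≢a (suc-injective eq)) (λ eq → i≢b (suc-injective eq)) (punchIn j c)
    }

det-swap {a = zero}  {zero}  a≢b _  = ⊥-elim (a≢b refl)
det-swap {a = suc a} {suc b} a≢b sw = det-swap-suc (λ eq → a≢b (cong suc eq)) sw
det-swap {a = zero}  {suc b} _   sw = det-swap₀ sw
det-swap {a = suc a} {zero}  _   sw = det-swap₀ (RowSwap-sym sw)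

det-swap₀ {b = zero}  sw = det-swap₀₁ sw
det-swap₀ {b = suc b} {A} {B} sw = begin
  det B                         ≡⟨ ℤP.neg-involutive (det B) ⟨
  - - det B                     ≡⟨ cong -_ (det-swap₀₁ (swap₀₁-RowSwap B)) ⟨
  - det (swap₀₁ B)              ≡⟨ cong -_ (det-swap-suc (λ ()) conjugated) ⟩
  - - det (swap₀₁ A)            ≡⟨ ℤP.neg-involutive (det (swap₀₁ A)) ⟩
  det (swap₀₁ A)                ≡⟨ det-swap₀₁ (swap₀₁-RowSwap A) ⟩
  - det A                       ∎
  where
  open RowSwap sw
  conjugated : RowSwap (suc zero) (suc (suc b)) (swap₀₁ A) (swap₀₁ B)
  conjugated = record { at-a = at-a ; at-b = at-b ; elsewhere = other }
    where
    other : ∀ i → i ≢ suc zero → i ≢ suc (suc b) → ∀ j → swap₀₁ B i j ≡ swap₀₁ A i j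
    other zero          _   _   = elsewhere (suc zero) (λ ()) (λ ())
    other (suc zero)    i≢1 _   = ⊥-elim (i≢1 refl)
    other (suc (suc i)) _   i≢b = elsewhere (suc (suc i)) (λ ()) i≢b

det-equal-rows : ∀ {n} {a b : Fin n} (A : Mat n) → a ≢ b → (∀ j → A a j ≡ A b j) → det A ≡ + 0
det-equal-rows A a≢b same = self-negating (det A) (det-swap a≢b (record
  { at-a = same ; at-b = λ j → sym (same j) ; elsewhere = λ _ _ _ _ → refl }))

det-scale-row : ∀ {n} {A B : Mat n} (r : Fin n) (x : ℤ) → (∀ j → B r j ≡ x * A r j) →
  (∀ i → i ≢ r → ∀ j → B i j ≡ A i j) → det B ≡ x * det A
det-scale-row {suc n} {A} {B} zero x row-r others =
  trans (Σ-cong λ j → trans (cong₂ (λ u d → sign (toℕ j) * (u * d)) (row-r j)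
                               (det-cong (λ a b → others (suc a) (λ ()) (punchIn j b))))
                             (pull-out (sign (toℕ j)) x (A zero j) (det (minor A j))))
        (sym (*-distribˡ-Σ x (row₀-term A)))
  where
  pull-out : ∀ s x a d → s * ((x * a) * d) ≡ x * (s * (a * d))
  pull-out = solve-∀
det-scale-row {suc n} {A} {B} (suc r) x row-r others =
  trans (Σ-cong λ j → trans (cong₂ (λ u d → sign (toℕ j) * (u * d)) (others zero (λ ()) j)
                               (det-scale-row r x (λ b → row-r (punchIn j b))
                                  (λ a a≢r b → others (suc a) (λ eq → a≢r (suc-injective eq)) (punchIn j b))))
                             (pull-out (sign (toℕ j)) x (A zero j) (det (minor A j))))
        (sym (*-distribˡ-Σ x (row₀-term A)))
  where
  pull-out : ∀ s x a d → s * (a * (x * d)) ≡ x * (s * (a * d))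
  pull-out = solve-∀

det-add-multiples : ∀ {n} {A B : Mat n} (k : Fin n) (c : Fin n → ℤ) → c k ≡ + 0 →
  (∀ i j → B i j ≡ A i j + c i * A k j) → det B ≡ det A
det-add-multiples-suc : ∀ {n} {A B : Mat (suc n)} (k : Fin n) (c : Fin (suc n) → ℤ) → c (suc k) ≡ + 0 →
  (∀ i j → B i j ≡ A i j + c i * A (suc k) j) → det B ≡ det A

det-add-multiples-suc {n} {A} {B} k c ck≡0 B≡ = begin
  det B
    ≡⟨ Σ-cong (λ j → cong₂ (λ u d → sign (toℕ j) * (u * d)) (B≡ zero j)
         (det-add-multiples {A = minor A j} {B = minor B j} k (λ i → c (suc i)) ck≡0 (λ a b → B≡ (suc a) (punchIn j b)))) ⟩
  Σ (λ j → sign (toℕ j) * ((A zero j + c zero * A (suc k) j) * det (minor A j)))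
    ≡⟨ Σ-cong (λ j → expand (sign (toℕ j)) (A zero j) (c zero) (A (suc k) j) (det (minor A j))) ⟩
  Σ (λ j → row₀-term A j + c zero * row₀-term A-with-row-k j)
    ≡⟨ Σ-distrib-+ (row₀-term A) (λ j → c zero * row₀-term A-with-row-k j) ⟩
  det A + Σ (λ j → c zero * row₀-term A-with-row-k j)
    ≡⟨ cong (λ x → det A + x) (*-distribˡ-Σ (c zero) (row₀-term A-with-row-k)) ⟨
  det A + c zero * det A-with-row-k
    ≡⟨ cong (λ x → det A + c zero * x) (det-equal-rows {a = zero} {b = suc k} A-with-row-k (λ ()) (λ _ → refl)) ⟩
  det A + c zero * + 0
    ≡⟨ drop (det A) (c zero) ⟩
  det A ∎
  where
  A-with-row-k : Mat (suc n)
  A-with-row-k zero    = A (suc k)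
  A-with-row-k (suc i) = A (suc i)
  expand : ∀ s a x b d → s * ((a + x * b) * d) ≡ s * (a * d) + x * (s * (b * d))
  expand = solve-∀
  drop : ∀ a x → a + x * + 0 ≡ a
  drop = solve-∀

det-add-multiples {suc zero} {A} {B} zero c c0≡0 B≡ = det-cong {A = B} {B = A} λ { zero j → trans (B≡ zero j) (drop c0≡0) }
  where
  drop : ∀ {x a} → x ≡ + 0 → a + x * a ≡ a
  drop {a = a} refl = ℤP.+-identityʳ a
det-add-multiples {suc (suc n)} {A} {B} zero c c0≡0 B≡ = begin
  det B                   ≡⟨ ℤP.neg-involutive (det B) ⟨
  - - det B               ≡⟨ cong -_ (det-swap₀₁ (swap₀₁-RowSwap B)) ⟨
  - det (swap₀₁ B)        ≡⟨ cong -_ (det-add-multiples-suc {A = swap₀₁ A} {B = swap₀₁ B} zero (swap₀₁ c) c0≡0 swapped) ⟩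
  - det (swap₀₁ A)        ≡⟨ cong -_ (det-swap₀₁ (swap₀₁-RowSwap A)) ⟩
  - - det A               ≡⟨ ℤP.neg-involutive (det A) ⟩
  det A                   ∎
  where
  swapped : ∀ i j → swap₀₁ B i j ≡ swap₀₁ A i j + swap₀₁ c i * swap₀₁ A (suc zero) j
  swapped zero          = B≡ (suc zero)
  swapped (suc zero)    = B≡ zero
  swapped (suc (suc i)) = B≡ (suc (suc i))
det-add-multiples {suc n} {A} {B} (suc k) c ck≡0 B≡ = det-add-multiples-suc {A = A} {B = B} k c ck≡0 B≡

module _ {n} (a b : Fin n) where

  transpose-a : PC.transpose a b a ≡ b
  transpose-a rewrite dec-true (a Fin.≟ a) refl = refl

  transpose-b : PC.transpose a b b ≡ a
  transpose-b with b Fin.≟ a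
  ... | yes b≡a = b≡a
  ... | no  _   rewrite dec-true (b Fin.≟ b) refl = refl

  transpose-other : ∀ {i} → i ≢ a → i ≢ b → PC.transpose a b i ≡ i
  transpose-other {i} i≢a i≢b rewrite dec-false (i Fin.≟ a) i≢a | dec-false (i Fin.≟ b) i≢b = refl

  transpose-RowSwap : (A : Mat n) → RowSwap a b A (λ i → A (PC.transpose a b i))
  transpose-RowSwap A = record
    { at-a = λ j → cong (λ r → A r j) transpose-a
    ; at-b = λ j → cong (λ r → A r j) transpose-b
    ; elsewhere = λ i i≢a i≢b j → cong (λ r → A r j) (transpose-other i≢a i≢b)
    }

det-permute-transpose : ∀ {n} (a b : Fin n) (A : Mat n) → det (permute (Perm.transpose a b) A) ≡ det A
det-permute-transpose a b A with a Fin.≟ b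
... | yes refl = det-cong (λ i j → cong₂ A (transpose-self i) (transpose-self j))
  where
  transpose-self : ∀ i → PC.transpose a a i ≡ i
  transpose-self i = by-cases (i Fin.≟ a)
    where
    by-cases : Dec (i ≡ a) → PC.transpose a a i ≡ i
    by-cases (yes i≡a) = trans (cong (PC.transpose a a) i≡a) (trans (transpose-a a a) (sym i≡a))
    by-cases (no  i≢a) = transpose-other a a i≢a i≢a
... | no a≢b = begin
  det (permute (Perm.transpose a b) A)   ≡⟨ det-swap a≢b (transpose-RowSwap a b D) ⟩
  - det D                                ≡⟨ cong -_ (det-transpose D) ⟨
  - det (transpose D)                    ≡⟨ cong -_ (det-swap a≢b (transpose-RowSwap a b (transpose A))) ⟩
  - - det (transpose A)                  ≡⟨ ℤP.neg-involutive _ ⟩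
  det (transpose A)                      ≡⟨ det-transpose A ⟩
  det A                                  ∎
  where
  D : Mat _
  D i j = A i (PC.transpose a b j)

det-permute-fixing-above : ∀ {n} m (π : Permutation′ n) → (∀ i → m ℕ.≤ toℕ i → π ⟨$⟩ʳ i ≡ i) →
  (A : Mat n) → det (permute π A) ≡ det A
det-permute-fixing-above zero π fixed A = det-cong (λ i j → cong₂ A (fixed i ℕ.z≤n) (fixed j ℕ.z≤n))
-- Composing π with the transposition of m and π m makes it fix m as well.
det-permute-fixing-above {n} (suc m) π fixed A with m ℕ.<? n
... | no m≮n = det-permute-fixing-above m π (λ i m≤i → ⊥-elim (m≮n (ℕ.≤-<-trans m≤i (Fin.toℕ<n i)))) A
... | yes m<n = begin
  det (permute π A)                   ≡⟨ det-cong (λ i j → cong₂ A (involution i) (involution j)) ⟨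
  det (permute π′ (permute τ A))      ≡⟨ det-permute-fixing-above m π′ fixed′ (permute τ A) ⟩
  det (permute τ A)                   ≡⟨ det-permute-transpose r (π ⟨$⟩ʳ r) A ⟩
  det A                               ∎
  where
  r : Fin n
  r = fromℕ< m<n
  τ π′ : Permutation′ n
  τ = Perm.transpose r (π ⟨$⟩ʳ r)
  π′ = π Perm.∘ₚ Perm.transpose (π ⟨$⟩ʳ r) r
  involution : ∀ i → τ ⟨$⟩ʳ (π′ ⟨$⟩ʳ i) ≡ π ⟨$⟩ʳ i
  involution i = PC.transpose-inverse r (π ⟨$⟩ʳ r)
  fixed′ : ∀ i → m ℕ.≤ toℕ i → π′ ⟨$⟩ʳ i ≡ i
  fixed′ i m≤i with toℕ i ℕ.≟ m
  ... | yes i≡m = trans (cong (π′ ⟨$⟩ʳ_) i≡r) (trans (transpose-a (π ⟨$⟩ʳ r) r) (sym i≡r))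
    where
    i≡r : i ≡ r
    i≡r = Fin.toℕ-injective (trans i≡m (sym (Fin.toℕ-fromℕ< m<n)))
  ... | no  i≢m = trans (cong (PC.transpose (π ⟨$⟩ʳ r) r) πi≡i) (transpose-other (π ⟨$⟩ʳ r) r i≢πr i≢r)
    where
    πi≡i : π ⟨$⟩ʳ i ≡ i
    πi≡i = fixed i (ℕ.≤∧≢⇒< m≤i (λ m≡i → i≢m (sym m≡i)))
    i≢r : i ≢ r
    i≢r i≡r = i≢m (trans (cong toℕ i≡r) (Fin.toℕ-fromℕ< m<n))
    i≢πr : i ≢ π ⟨$⟩ʳ r
    i≢πr i≡πr = i≢r (trans (sym (Perm.inverseˡ π)) (trans (cong (π ⟨$⟩ˡ_) (trans πi≡i i≡πr)) (Perm.inverseˡ π)))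

det-permute : ∀ {n} (π : Permutation′ n) (A : Mat n) → det (permute π A) ≡ det A
det-permute {n} π = det-permute-fixing-above n π (λ i n≤i → ⊥-elim (ℕ.<⇒≱ (Fin.toℕ<n i) n≤i))

-- Determinants modulo 4

double : ∀ {n} → Mat n → Mat n
double X i j = + 2 * X i j

a+2y≡a : ∀ a y → a + + 2 * y ≡[ + 2 ] a
a+2y≡a a y = congruent (divides y (cancel a y))
  where
  cancel : ∀ a y → a + + 2 * y - a ≡ y * + 2
  cancel = solve-∀

second-difference-step : ∀ s a x y t u p r → t + u ≡[ + 4 ] p + r → t ≡[ + 2 ] p → t ≡[ + 2 ] r →
  s * ((a + + 2 * x + + 2 * y) * t) + s * (a * u) ≡[ + 4 ] s * ((a + + 2 * x) * p) + s * ((a + + 2 * y) * r)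
second-difference-step s a x y t u p r (congruent 4∣d₁) (congruent 2∣d₂) (congruent 2∣d₃) =
  congruent (subst (+ 4 ∣_) (difference s a x y t u p r)
    (∣n⇒∣m*n s (∣m∣n⇒∣m+n (∣m∣n⇒∣m+n (∣n⇒∣m*n a 4∣d₁)
                                      (∣n⇒∣m*n x (*-monoʳ-∣ (+ 2) 2∣d₂)))
                          (∣n⇒∣m*n y (*-monoʳ-∣ (+ 2) 2∣d₃)))))
  where
  difference : ∀ s a x y t u p r →
    s * (a * ((t + u) - (p + r)) + x * (+ 2 * (t - p)) + y * (+ 2 * (t - r)))
    ≡ (s * ((a + + 2 * x + + 2 * y) * t) + s * (a * u)) - (s * ((a + + 2 * x) * p) + s * ((a + + 2 * y) * r))
  difference = solve-∀

det-second-difference : ∀ {n} (A X Y : Mat n) →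
  det ((A +ᴹ double X) +ᴹ double Y) + det A ≡[ + 4 ] det (A +ᴹ double X) + det (A +ᴹ double Y)
det-second-difference {zero}  A X Y = mod-refl
det-second-difference {suc n} A X Y =
  subst₂ (_≡[ + 4 ]_) (Σ-distrib-+ (row₀-term ((A +ᴹ double X) +ᴹ double Y)) (row₀-term A))
                      (Σ-distrib-+ (row₀-term (A +ᴹ double X)) (row₀-term (A +ᴹ double Y)))
    (Σ-mod λ j → second-difference-step (sign (toℕ j)) (A zero j) (X zero j) (Y zero j) _ _ _ _
      (det-second-difference (minor A j) (minor X j) (minor Y j))
      (det-mod (λ a b → a+2y≡a (A′ j a b + + 2 * X′ j a b) (Y′ j a b)))
      (det-mod (λ a b → mod-trans (a+2y≡a (A′ j a b + + 2 * X′ j a b) (Y′ j a b))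
                          (mod-trans (a+2y≡a (A′ j a b) (X′ j a b))
                                     (mod-sym (a+2y≡a (A′ j a b) (Y′ j a b)))))))
  where
  A′ X′ Y′ : Fin (suc n) → Mat n
  A′ = minor A
  X′ = minor X
  Y′ = minor Y

det-symmetric-+2U+2Uᵗ : ∀ {n} (S U : Mat n) → (∀ i j → S i j ≡ S j i) →
  det ((S +ᴹ double U) +ᴹ double (transpose U)) ≡[ + 4 ] det S
-- (S + 2U)ᵗ = S + 2Uᵗ, so by the second difference the left side plus det S is ≡ 2 det(S + 2U) ≡ 2 det S.
det-symmetric-+2U+2Uᵗ S U S-sym = mod-cancel
  (subst (λ r → det ((S +ᴹ double U) +ᴹ double (transpose U)) + det S ≡[ + 4 ] det (S +ᴹ double U) + r) det-R≡det-P (det-second-difference S U (transpose U)))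
  (det-mod (λ i j → mod-sym (a+2y≡a (S i j) (U i j))))
  where
  det-R≡det-P : det (S +ᴹ double (transpose U)) ≡ det (S +ᴹ double U)
  det-R≡det-P = trans (det-cong (λ i j → cong (λ x → x + double U j i) (S-sym i j))) (det-transpose (S +ᴹ double U))

-- The matrices V and 𝔖

≡ᵇ-refl : ∀ {n} (i : Fin n) → (toℕ i ℕ.≡ᵇ toℕ i) ≡ true
≡ᵇ-refl i = dec-true (toℕ i ℕ.≟ toℕ i) refl

≡ᵇ-≢ : ∀ {n} {i l : Fin n} → i ≢ l → (toℕ i ℕ.≡ᵇ toℕ l) ≡ false
≡ᵇ-≢ {i = i} {l} i≢l = dec-false (toℕ i ℕ.≟ toℕ l) (λ eq → i≢l (Fin.toℕ-injective eq))

module _ {n} (X : Mat n) where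

  V-< : ∀ {i j} → toℕ i ℕ.< toℕ j → V X i j ≡ X i j
  V-< {i} {j} i<j = cong (λ b → if b then X i j else (if toℕ i ℕ.≡ᵇ toℕ j then + 1 else + 0))
                         (dec-true (toℕ i ℕ.<? toℕ j) i<j)

  V-> : ∀ {i j} → toℕ j ℕ.< toℕ i → V X i j ≡ + 0
  V-> {i} {j} j<i = trans (cong (λ b → if b then X i j else (if toℕ i ℕ.≡ᵇ toℕ j then + 1 else + 0))
                                (dec-false (toℕ i ℕ.<? toℕ j) (ℕ.<-asym j<i)))
                          (cong (λ b → if b then + 1 else + 0) (dec-false (toℕ i ℕ.≟ toℕ j) (ℕ.>⇒≢ j<i)))

  V-diag : ∀ i → V X i i ≡ + 1
  V-diag i = trans (cong (λ b → if b then X i i else (if toℕ i ℕ.≡ᵇ toℕ i then + 1 else + 0))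
                         (dec-false (toℕ i ℕ.<? toℕ i) (ℕ.<-irrefl refl)))
                   (cong (λ b → if b then + 1 else + 0) (≡ᵇ-refl i))

skew-diag : ∀ {n} (B : Mat n) → IsSkewSymmetric B → ∀ i → B i i ≡ + 0
skew-diag B B-skew i = self-negating (B i i) (B-skew i i)

V-skew : ∀ {n} (B : Mat n) → IsSkewSymmetric B → ∀ i j → V B i j - V B j i ≡ B i j
V-skew B B-skew i j with ℕ.<-cmp (toℕ i) (toℕ j)
... | tri< i<j _ _ = trans (cong₂ _-_ (V-< B i<j) (V-> B i<j)) (ℤP.+-identityʳ (B i j))
... | tri> _ _ j<i = trans (cong₂ _-_ (V-> B j<i) (V-< B j<i)) (trans (ℤP.+-identityˡ (- B j i)) (sym (B-skew i j)))
... | tri≈ _ i≡j _ rewrite Fin.toℕ-injective i≡j = trans (ℤP.+-inverseʳ (V B j j)) (sym (skew-diag B B-skew j))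

𝔖-cong : ∀ {n} {A B : Mat n} → (∀ i j → A i j ≡ B i j) → ∀ i j → 𝔖 A i j ≡ 𝔖 B i j
𝔖-cong {A = A} {B} A≗B i j = cong₂ _+_ (V-cong i j) (V-cong j i)
  where
  V-cong : ∀ i j → V A i j ≡ V B i j
  V-cong i j = cong (λ x → if toℕ i ℕ.<ᵇ toℕ j then x else (if toℕ i ℕ.≡ᵇ toℕ j then + 1 else + 0)) (A≗B i j)

𝔖-mod-2 : ∀ {n} {X : Mat n} → (∀ i j → X i j ≡[ + 2 ] X j i) → (∀ i → + 2 ∣ X i i) →
  ∀ i j → 𝔖 X i j ≡[ + 2 ] X i j
𝔖-mod-2 {X = X} X-sym X-even i j with ℕ.<-cmp (toℕ i) (toℕ j)
... | tri< i<j _ _ = mod-reflexive (trans (cong₂ _+_ (V-< X i<j) (V-> X i<j)) (ℤP.+-identityʳ (X i j)))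
... | tri> _ _ j<i = mod-trans (mod-reflexive (trans (cong₂ _+_ (V-> X j<i) (V-< X j<i)) (ℤP.+-identityˡ (X j i)))) (X-sym j i)
... | tri≈ _ i≡j _ rewrite Fin.toℕ-injective i≡j =
  mod-trans (mod-reflexive (cong₂ _+_ (V-diag X j) (V-diag X j)))
            (congruent (∣m∣n⇒∣m-n (divides (+ 1) refl) (X-even j)))

𝔖-skew-mod-2 : ∀ {n} (B : Mat n) → IsSkewSymmetric B → ∀ i j → 𝔖 B i j ≡[ + 2 ] B i j
𝔖-skew-mod-2 B B-skew = 𝔖-mod-2 (λ i j → subst (_≡[ + 2 ] B j i) (sym (B-skew i j)) (neg≡ (B j i)))
                                       (λ i → divides (+ 0) (skew-diag B B-skew i))
  where
  neg≡ : ∀ x → - x ≡[ + 2 ] x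
  neg≡ x = congruent (divides (- x) (double-neg x))
    where
    double-neg : ∀ x → - x - x ≡ - x * + 2
    double-neg = solve-∀

det-symmetrization-mod-4 : ∀ {n} (X Y : Mat n) → (∀ i j → X i j - X j i ≡ Y i j - Y j i) →
  (∀ i → X i i ≡[ + 2 ] Y i i) → det (X +ᴹ transpose X) ≡[ + 4 ] det (Y +ᴹ transpose Y)
det-symmetrization-mod-4 {n} X Y same-skew same-parity =
  mod-trans (det-mod entry) (det-symmetric-+2U+2Uᵗ (Y +ᴹ transpose Y) (V W) (λ i j → ℤP.+-comm (Y i j) (Y j i)))
  where
  W : Mat n
  W i j = X i j - Y i j
  W-sym : ∀ i j → W i j ≡ W j i
  W-sym i j = ℤP.i-j≡0⇒i≡j (W i j) (W j i)
    (trans (regroup (X i j) (X j i) (Y i j) (Y j i))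
           (trans (cong (_- (Y i j - Y j i)) (same-skew i j)) (ℤP.+-inverseʳ (Y i j - Y j i))))
    where
    regroup : ∀ xij xji yij yji → (xij - yij) - (xji - yji) ≡ (xij - xji) - (yij - yji)
    regroup = solve-∀
  X+Xᵗ≡ : ∀ i j → X i j + X j i ≡ (Y i j + Y j i) + + 2 * W i j
  X+Xᵗ≡ i j = begin
    X i j + X j i
      ≡⟨ regroup (X i j) (X j i) (Y i j) (Y j i) ⟩
    (Y i j + Y j i) + + 2 * W i j - ((X i j - X j i) - (Y i j - Y j i))
      ≡⟨ cong (λ d → (Y i j + Y j i) + + 2 * W i j - (d - (Y i j - Y j i))) (same-skew i j) ⟩
    (Y i j + Y j i) + + 2 * W i j - ((Y i j - Y j i) - (Y i j - Y j i))
      ≡⟨ cancel (Y i j + Y j i + + 2 * W i j) (Y i j - Y j i) ⟩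
    (Y i j + Y j i) + + 2 * W i j ∎
    where
    regroup : ∀ xij xji yij yji → xij + xji ≡ (yij + yji) + + 2 * (xij - yij) - ((xij - xji) - (yij - yji))
    regroup = solve-∀
    cancel : ∀ a d → a - (d - d) ≡ a
    cancel = solve-∀
  entry : ∀ i j → X i j + X j i ≡[ + 4 ] (Y i j + Y j i + + 2 * V W i j) + + 2 * V W j i
  entry i j = mod-trans (mod-reflexive (X+Xᵗ≡ i j))
    (mod-trans (mod-+ (mod-refl {a = Y i j + Y j i})
                      (double-mod (mod-sym (𝔖-mod-2 (λ i j → mod-reflexive (W-sym i j))
                                                    (λ i → ∣difference (same-parity i)) i j))))
               (mod-reflexive (distribute (Y i j + Y j i) (V W i j) (V W j i))))
    where
    distribute : ∀ s a b → s + + 2 * (a + b) ≡ (s + + 2 * a) + + 2 * b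
    distribute = solve-∀

-- Mutations

-- ε k is the diagonal of J k, and e B k is the k-th column of E B k.
ε : ∀ {n} → Fin n → Fin n → ℤ
ε k i = if toℕ i ℕ.≡ᵇ toℕ k then - + 1 else + 1

e : ∀ {n} → Mat n → Fin n → Fin n → ℤ
e B k i = + 0 ⊔ - B i k

ε-square : ∀ {n} (k i : Fin n) → ε k i * ε k i ≡ + 1
ε-square k i with toℕ i ℕ.≡ᵇ toℕ k
... | true  = refl
... | false = refl

ε-odd : ∀ {n} (k i : Fin n) → ε k i ≡[ + 2 ] + 1
ε-odd k i with toℕ i ℕ.≡ᵇ toℕ k
... | true  = congruent (divides (- + 1) refl)
... | false = mod-refl

e-annihilates : ∀ {n} (B : Mat n) k i → e B k i * (B i k + e B k i) ≡ + 0
e-annihilates B k i with B i k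
... | + zero   = refl
... | + suc _  = refl
... | -[1+ m ] = trans (cong (+ suc m *_) (ℤP.+-inverseˡ (+ suc m))) (ℤP.*-zeroʳ (+ suc m))

e-diag : ∀ {n} (B : Mat n) → IsSkewSymmetric B → ∀ k → e B k k ≡ + 0
e-diag B B-skew k = cong (λ b → + 0 ⊔ - b) (skew-diag B B-skew k)

module _ {n} (B : Mat n) (k : Fin n) where

  Mk·-entry : ∀ (X : Mat n) i j → (Mk B k · X) i j ≡ ε k i * X i j + e B k i * X k j
  Mk·-entry X i j = begin
    Σ (λ l → (J k i l + E B k i l) * X l j)
      ≡⟨ Σ-cong (λ l → ℤP.*-distribʳ-+ (X l j) (J k i l) (E B k i l)) ⟩
    Σ (λ l → J k i l * X l j + E B k i l * X l j)
      ≡⟨ Σ-distrib-+ (λ l → J k i l * X l j) (λ l → E B k i l * X l j) ⟩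
    Σ (λ l → J k i l * X l j) + Σ (λ l → E B k i l * X l j)
      ≡⟨ cong₂ _+_ (Σ-single i (λ l → J k i l * X l j) J-off) (Σ-single k (λ l → E B k i l * X l j) E-off) ⟩
    J k i i * X i j + E B k i k * X k j
      ≡⟨ cong₂ (λ u v → u * X i j + v * X k j)
           (cong (λ b → if b then ε k i else + 0) (≡ᵇ-refl i))
           (cong (λ b → if b then e B k i else + 0) (≡ᵇ-refl k)) ⟩
    ε k i * X i j + e B k i * X k j ∎
    where
    J-off : ∀ l → l ≢ i → J k i l * X l j ≡ + 0
    J-off l l≢i = cong (λ b → (if b then ε k i else + 0) * X l j) (≡ᵇ-≢ (λ i≡l → l≢i (sym i≡l)))
    E-off : ∀ l → l ≢ k → E B k i l * X l j ≡ + 0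
    E-off l l≢k = cong (λ b → (if b then e B k i else + 0) * X l j) (≡ᵇ-≢ l≢k)

  ·Mkᵗ-entry : ∀ (X : Mat n) i j → (X · transpose (Mk B k)) i j ≡ ε k j * X i j + e B k j * X i k
  ·Mkᵗ-entry X i j = trans (Σ-cong (λ l → ℤP.*-comm (X i l) (Mk B k j l))) (Mk·-entry (transpose X) j i)

  Mk-conj : Mat n → Mat n
  Mk-conj X i j = ε k j * (ε k i * X i j + e B k i * X k j) + e B k j * (ε k i * X i k + e B k i * X k k)

  Mk-conj-entry : ∀ (X : Mat n) i j → ((Mk B k · X) · transpose (Mk B k)) i j ≡ Mk-conj X i j
  Mk-conj-entry X i j = trans (·Mkᵗ-entry (Mk B k · X) i j)
    (cong₂ (λ u v → ε k j * u + e B k j * v) (Mk·-entry X i j) (Mk·-entry X i k))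

  Mk-conj-skew : ∀ {X Y : Mat n} → (∀ i j → X i j ≡ Y i j - Y j i) → ∀ i j → Mk-conj X i j ≡ Mk-conj Y i j - Mk-conj Y j i
  Mk-conj-skew {X} {Y} X≡ i j = trans
    (cong₂ (λ u v → ε k j * u + e B k j * v)
       (cong₂ (λ u v → ε k i * u + e B k i * v) (X≡ i j) (X≡ k j))
       (cong₂ (λ u v → ε k i * u + e B k i * v) (X≡ i k) (X≡ k k)))
    (expand (ε k i) (ε k j) (e B k i) (e B k j) (Y i j) (Y j i) (Y k j) (Y j k) (Y i k) (Y k i) (Y k k))
    where
    expand : ∀ si sj ci cj yij yji ykj yjk yik yki ykk →
      sj * (si * (yij - yji) + ci * (ykj - yjk)) + cj * (si * (yik - yki) + ci * (ykk - ykk))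
      ≡ (sj * (si * yij + ci * ykj) + cj * (si * yik + ci * ykk)) - (si * (sj * yji + cj * yki) + ci * (sj * yjk + cj * ykk))
    expand = solve-∀

  Mk-conj-sym : ∀ (X : Mat n) i j → Mk-conj (X +ᴹ transpose X) i j ≡ Mk-conj X i j + Mk-conj X j i
  Mk-conj-sym X i j = expand (ε k i) (ε k j) (e B k i) (e B k j) (X i j) (X j i) (X k j) (X j k) (X i k) (X k i) (X k k)
    where
    expand : ∀ si sj ci cj xij xji xkj xjk xik xki xkk →
      sj * (si * (xij + xji) + ci * (xkj + xjk)) + cj * (si * (xik + xki) + ci * (xkk + xkk))
      ≡ (sj * (si * xij + ci * xkj) + cj * (si * xik + ci * xkk)) + (si * (sj * xji + cj * xki) + ci * (sj * xjk + cj * xkk))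
    expand = solve-∀

  module _ (ekk≡0 : e B k k ≡ + 0) where

    det-Mk· : ∀ (X : Mat n) → det (Mk B k · X) ≡ - det X
    det-Mk· X = begin
      det (Mk B k · X)     ≡⟨ det-scale-row {A = Z} k (- + 1) row-k other-rows ⟩
      - + 1 * det Z        ≡⟨ cong (- + 1 *_) (det-add-multiples {A = X} {B = Z} k (e B k) ekk≡0 (λ _ _ → refl)) ⟩
      - + 1 * det X        ≡⟨ ℤP.-1*i≡-i (det X) ⟩
      - det X              ∎
      where
      Z : Mat n
      Z i j = X i j + e B k i * X k j
      row-k : ∀ j → (Mk B k · X) k j ≡ - + 1 * Z k j
      row-k j = begin
        (Mk B k · X) k j                   ≡⟨ Mk·-entry X k j ⟩
        ε k k * X k j + e B k k * X k j    ≡⟨ cong (λ b → (if b then - + 1 else + 1) * X k j + e B k k * X k j) (≡ᵇ-refl k) ⟩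
        - + 1 * X k j + e B k k * X k j    ≡⟨ cong (λ c → - + 1 * X k j + c * X k j) ekk≡0 ⟩
        - + 1 * X k j + + 0 * X k j        ≡⟨ factor (X k j) ⟩
        - + 1 * (X k j + + 0 * X k j)      ≡⟨ cong (λ c → - + 1 * (X k j + c * X k j)) ekk≡0 ⟨
        - + 1 * Z k j                      ∎
        where
        factor : ∀ x → - + 1 * x + + 0 * x ≡ - + 1 * (x + + 0 * x)
        factor = solve-∀
      other-rows : ∀ i → i ≢ k → ∀ j → (Mk B k · X) i j ≡ Z i j
      other-rows i i≢k j = trans (Mk·-entry X i j)
        (trans (cong (λ b → (if b then - + 1 else + 1) * X i j + e B k i * X k j) (≡ᵇ-≢ i≢k))
               (cong (_+ e B k i * X k j) (ℤP.*-identityˡ (X i j))))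

    det-·Mkᵗ : ∀ (X : Mat n) → det (X · transpose (Mk B k)) ≡ - det X
    det-·Mkᵗ X = begin
      det (X · transpose (Mk B k))
        ≡⟨ det-cong (λ i j → Σ-cong (λ l → ℤP.*-comm (X i l) (Mk B k j l))) ⟩
      det (transpose (Mk B k · transpose X))
        ≡⟨ det-transpose (Mk B k · transpose X) ⟩
      det (Mk B k · transpose X)
        ≡⟨ det-Mk· (transpose X) ⟩
      - det (transpose X)
        ≡⟨ cong -_ (det-transpose X) ⟩
      - det X ∎

    det-Mk-conj : ∀ (X : Mat n) → det ((Mk B k · X) · transpose (Mk B k)) ≡ det X
    det-Mk-conj X = trans (det-·Mkᵗ (Mk B k · X)) (trans (cong -_ (det-Mk· X)) (ℤP.neg-involutive (det X)))

odd-diagonal : ∀ s c vii vik vki vkk b → s * s ≡ + 1 → s ≡[ + 2 ] + 1 → vii ≡ + 1 → vkk ≡ + 1 →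
  vik + vki ≡[ + 2 ] b → c * (b + c) ≡ + 0 → s * (s * vii + c * vki) + c * (s * vik + c * vkk) ≡[ + 2 ] + 1
odd-diagonal s c _ vik vki _ b s²≡1 s≡1 refl refl vik+vki≡b c[b+c]≡0 =
  mod-trans (mod-reflexive (expand s c vik vki))
  (mod-trans (mod-+ (mod-+ (mod-reflexive s²≡1) (mod-* (mod-* s≡1 (mod-refl {a = c})) vik+vki≡b)) (mod-refl {a = c * c}))
  (mod-reflexive (trans (collect c b) (cong (λ x → + 1 + x) c[b+c]≡0))))
  where
  expand : ∀ s c vik vki → s * (s * + 1 + c * vki) + c * (s * vik + c * + 1) ≡ s * s + s * c * (vik + vki) + c * c
  expand = solve-∀
  collect : ∀ c b → + 1 + + 1 * c * b + c * c ≡ + 1 + c * (b + c)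
  collect = solve-∀

Mk-conj-V-diag-odd : ∀ {n} (B : Mat n) → IsSkewSymmetric B → ∀ k i → Mk-conj B k (V B) i i ≡[ + 2 ] + 1
Mk-conj-V-diag-odd B B-skew k i =
  odd-diagonal (ε k i) (e B k i) _ (V B i k) (V B k i) _ (B i k) (ε-square k i) (ε-odd k i) (V-diag B i) (V-diag B k)
               (𝔖-skew-mod-2 B B-skew i k) (e-annihilates B k i)

module _ {n} (B : Mat n) (B-skew : IsSkewSymmetric B) (k : Fin n) where

  μ-via-V : ∀ i j → μ k B i j ≡ Mk-conj B k (V B) i j - Mk-conj B k (V B) j i
  μ-via-V i j = trans (Mk-conj-entry B k B i j) (Mk-conj-skew B k (λ i j → sym (V-skew B B-skew i j)) i j)

  μ-skew : IsSkewSymmetric (μ k B)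
  μ-skew i j = trans (μ-via-V i j) (trans (flip (Mk-conj B k (V B) i j) (Mk-conj B k (V B) j i)) (cong -_ (sym (μ-via-V j i))))
    where
    flip : ∀ a b → a - b ≡ - (b - a)
    flip = solve-∀

  det-𝔖-μ : det (𝔖 (μ k B)) ≡[ + 4 ] det (𝔖 B)
  det-𝔖-μ = mod-trans
    (det-symmetrization-mod-4 (V (μ k B)) F
      (λ i j → trans (V-skew (μ k B) μ-skew i j) (μ-via-V i j))
      (λ i → mod-trans (mod-reflexive (V-diag (μ k B) i)) (mod-sym (Mk-conj-V-diag-odd B B-skew k i))))
    (mod-reflexive (begin
      det (F +ᴹ transpose F)                      ≡⟨ det-cong (λ i j → Mk-conj-sym B k (V B) i j) ⟨
      det (Mk-conj B k (𝔖 B))                     ≡⟨ det-cong (Mk-conj-entry B k (𝔖 B)) ⟨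
      det ((Mk B k · 𝔖 B) · transpose (Mk B k))   ≡⟨ det-Mk-conj B k (e-diag B B-skew k) (𝔖 B) ⟩
      det (𝔖 B)                                   ∎))
    where
    F : Mat n
    F = Mk-conj B k (V B)

det-𝔖-mutations : ∀ {n} {B C : Mat n} → Mutations B C → IsSkewSymmetric B →
  IsSkewSymmetric C × det (𝔖 C) ≡[ + 4 ] det (𝔖 B)
det-𝔖-mutations done B-skew = B-skew , mod-refl
det-𝔖-mutations {B = B} {C} (step k rest) B-skew = proj₁ IH , mod-trans (proj₂ IH) (det-𝔖-μ B B-skew k)
  where
  IH : IsSkewSymmetric C × det (𝔖 C) ≡[ + 4 ] det (𝔖 (μ k B))
  IH = det-𝔖-mutations rest (μ-skew B B-skew k)

det-𝔖-permute : ∀ {n} (C : Mat n) → IsSkewSymmetric C → (σ : Permutation′ n) →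
  det (𝔖 (permute σ C)) ≡[ + 4 ] det (𝔖 C)
det-𝔖-permute C C-skew σ = mod-trans
  (det-symmetrization-mod-4 (V (permute σ C)) (permute σ (V C))
    (λ i j → trans (V-skew (permute σ C) (λ i j → C-skew (σ ⟨$⟩ʳ i) (σ ⟨$⟩ʳ j)) i j)
                   (sym (V-skew C C-skew (σ ⟨$⟩ʳ i) (σ ⟨$⟩ʳ j))))
    (λ i → mod-reflexive (trans (V-diag (permute σ C) i) (sym (V-diag C (σ ⟨$⟩ʳ i))))))
  (mod-reflexive (det-permute σ (𝔖 C)))

theorem1p6 : (n : ℕ) → 1 ≤ n → (B B' : Mat n) → IsSkewSymmetric B →
    MutationEquivalent B B' → δ B' ≡ δ B
theorem1p6 n _ B B' B-skew (C , σ , mutations , B'≡σC) = %ℕ-cong 4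
  (mod-trans (mod-reflexive (det-cong (𝔖-cong B'≡σC)))
  (mod-trans (det-𝔖-permute C (proj₁ C-invariants) σ)
             (proj₂ C-invariants)))
  where
  C-invariants : IsSkewSymmetric C × det (𝔖 C) ≡[ + 4 ] det (𝔖 B)
  C-invariants = det-𝔖-mutations mutations B-skew
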